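{- Fix an integer $k\ge0$. (1) Let $x_0:=0$ and $x_n:=m^{(k)}_{(n,0)}$ for $n\ge1$. Then $x_1=1$ and $x_n=(2k+3)x_{n-1}-x_{n-2}$ for all $n\ge2$. (2) Let $y_0:=0$ and $y_n:=m^{(k)}_{(n,n)}$ for $n\ge1$. Then $y_1=k+2$ and $y_n=(3k^2+8k+6)y_{n-1}-y_{n-2}$ for all $n\ge2$.
   Context: Let $\mathcal L$ be the union of all lines in $\mathbb R^2$ of slope $0$, $-1$ or $\infty$ through points of $\mathbb Z^2$, regarded as a union of edges (closed segments between consecutive integral points). To an oriented curve $\gamma$ crossing edges transversally away from integral points attach a poset $\mathcal P_\gamma$: let $\tau_1,\dots,\tau_r$ be the edges crossed, in order along $\gamma$. Each crossing with $\tau_i$ gives a chain $(\tau_i,0),\dots,(\tau_i,k)$, ordered $(\tau_i,0)\succ\cdots\succ(\tau_i,k)$ if the crossing point is strictly closer to the endpoint of $\tau_i$ to the right of $\gamma$, and $(\tau_i,0)\prec\cdots\prec(\tau_i,k)$ otherwise (including midpoint crossings). For consecutive crossings impose $(\tau_i,k)\succ(\tau_{i+1},0)$ if the common endpoint of $\tau_i,\tau_{i+1}$ lies to the right of $\gamma$, else $(\tau_i,k)\prec(\tau_{i+1},0)$; take the transitive closure. For $(p,q)\ne(0,0)$ with $g=\gcd(|p|,|q|)$, $\gamma^L_{(p,q)}$ is the segment from $(0,0)$ to $(p,q)$ (a concatenation of $g$ translates of the segment to $(p/g,q/g)$; a translate lying along an edge crosses no edges), oriented from $(0,0)$, modified near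 each of its $g-1$ interior integral points by a small arc passing to the left of that point. $m^{(k)}_{(p,q)}$ is the number of order ideals (down-closed subsets, including $\emptyset$) of $\mathcal P_{\gamma^L_{(p,q)}}$. -}

module Defs where

open import Data.Bool using (Bool; true; false; if_then_else_)
open import Data.Nat as ℕ using (ℕ; zero; suc; _∸_)
open import Data.Integer as ℤ using (ℤ; +_; _-_; _*_; _≤ᵇ_; ∣_∣)
import Data.Integer.Properties as ℤP
open import Data.Fin using (Fin; zero; suc; toℕ; inject₁; fromℕ)
open import Data.List using (List; []; _∷_; length; lookup; concatMap; upTo)
open import Data.List.Relation.Unary.Unique.Propositional using (Unique)
open import Data.List.Membership.Propositional using (_∈_)
open import Data.Vec as Vec using (Vec)
open import Data.Product using (_×_; _,_; Σ; ∃)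
open import Data.Product.Properties using (≡-dec)
open import Relation.Nullary using (yes; no)
open import Relation.Binary.PropositionalEquality using (_≡_)
open import Relation.Binary.Construct.Closure.ReflexiveTransitive using (Star)
open import Function.Bundles using (_⇔_)

Point : Set
Point = ℤ × ℤ

-- An edge of 𝓛: closed segment between two consecutive integral points
-- on a line of slope 0, -1 or ∞, recorded by its two endpoints.
record Edge : Set where
  constructor edge
  field
    end₁ end₂ : Point
open Edge public

_≟ₚ_ : (a b : Point) → Relation.Nullary.Dec (a ≡ b)
_≟ₚ_ = ≡-dec ℤ._≟_ ℤ._≟_

commonEndpoint : Edge → Edge → Point
commonEndpoint τ τ' with end₁ τ ≟ₚ end₁ τ' | end₁ τ ≟ₚ end₂ τ'
... | yes _ | _     = end₁ τ
... | no _  | yes _ = end₁ τ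
... | no _  | no _  = end₂ τ

-- The poset 𝓟_γ attached to an oriented curve γ, given its crossing data:
--   τs          : the edges crossed, in order along γ,
--   rightOf     : which points lie to the right of γ,
--   closerRight : whether the i-th crossing point is strictly closer to
--                 the endpoint of τᵢ lying to the right of γ.

module CurvePoset (k : ℕ) (τs : List Edge) (rightOf : Point → Bool)
                  (closerRight : Fin (length τs) → Bool) where

  r : ℕ
  r = length τs

  -- (τᵢ , j) is represented by (i , j), 0 ≤ j ≤ k.
  Elem : Set
  Elem = Fin r × Fin (suc k)

  -- Generating relations:  x ⋖ y  means  x ≺ y.
  data _⋖_ : Elem → Elem → Set where
    chainDown : ∀ i (j : Fin k) → closerRight i ≡ true →
                (i , suc j) ⋖ (i , inject₁ j)
    chainUp   : ∀ i (j : Fin k) → closerRight i ≡ false →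
                (i , inject₁ j) ⋖ (i , suc j)
    linkDown  : ∀ i i' → toℕ i' ≡ suc (toℕ i) →
                rightOf (commonEndpoint (lookup τs i) (lookup τs i')) ≡ true →
                (i' , zero) ⋖ (i , fromℕ k)
    linkUp    : ∀ i i' → toℕ i' ≡ suc (toℕ i) →
                rightOf (commonEndpoint (lookup τs i) (lookup τs i')) ≡ false →
                (i , fromℕ k) ⋖ (i' , zero)

  _≼_ : Elem → Elem → Set
  _≼_ = Star _⋖_

  SubsetP : Set
  SubsetP = Vec (Vec Bool (suc k)) r

  _∈ₛ_ : Elem → SubsetP → Set
  (i , j) ∈ₛ S = Vec.lookup (Vec.lookup S i) j ≡ true

  -- Order ideal: down-closed subset (∅ allowed).
  IsOrderIdeal : SubsetP → Set
  IsOrderIdeal S = ∀ x y → y ≼ x → x ∈ₛ S → y ∈ₛ S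

  NumOrderIdeals : ℕ → Set
  NumOrderIdeals m =
    Σ (List SubsetP) λ L →
      Unique L × (∀ S → IsOrderIdeal S ⇔ S ∈ L) × length L ≡ m

-- The curve γᴸ_(p,q): segment from (0,0) to (p,q), with small arcs
-- passing to the LEFT of the interior integral points.

-- cross (p,q) X > 0 : X strictly left of the line; < 0 : strictly right.
cross : ℤ × ℤ → Point → ℤ
cross (p , q) (x , y) = p * y - q * x

-- A point is to the right of γᴸ_(p,q) if it is strictly right of the
-- line, or lies on it (interior integral points: the arcs pass left).
rightOfγ : ℤ × ℤ → Point → Bool
rightOfγ pq X = cross pq X ≤ᵇ + 0

-- Crossing of an edge (A,B): distances of the crossing point to A and B
-- are proportional to ∣cross A∣ and ∣cross B∣ (for an arc crossing near an
-- interior integral point X on the line, ∣cross X∣ = 0 and the crossing is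
-- arbitrarily close to X).
closerRightγ : ℤ × ℤ → Edge → Bool
closerRightγ pq (edge A B) =
  if rightOfγ pq A then ∣ cross pq A ∣ ℕ.<ᵇ ∣ cross pq B ∣
                   else ∣ cross pq B ∣ ℕ.<ᵇ ∣ cross pq A ∣

-- Edges crossed by γᴸ_(n,0), n ≥ 1.  The segment lies along edges of
-- y = 0 and crosses nothing; the arc above each interior point (i,0),
-- 1 ≤ i ≤ n-1, crosses first the diagonal edge (i,0)–(i-1,1), then the
-- vertical edge (i,0)–(i,1).
edgesH : ℕ → List Edge
edgesH n = concatMap (λ j →
    edge (+ suc j , + 0) (+ j , + 1)
  ∷ edge (+ suc j , + 0) (+ suc j , + 1)
  ∷ []) (upTo (n ∸ 1))

-- Diagonal edge of the unit square [i,i+1]², crossed by γ at its midpoint.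
diagEdge : ℕ → Edge
diagEdge i = edge (+ i , + suc i) (+ suc i , + i)

-- Edges crossed by γᴸ_(n,n), n ≥ 1: the diagonal of the first square;
-- then, for each interior point (i,i), 1 ≤ i ≤ n-1, the arc on its
-- north-west side crosses (i,i)–(i-1,i), (i,i)–(i-1,i+1), (i,i)–(i,i+1),
-- followed by the diagonal of the square [i,i+1]².
edgesD : ℕ → List Edge
edgesD n = diagEdge 0 ∷ concatMap (λ j →
    edge (+ suc j , + suc j) (+ j , + suc j)
  ∷ edge (+ suc j , + suc j) (+ j , + suc (suc j))
  ∷ edge (+ suc j , + suc j) (+ suc j , + suc (suc j))
  ∷ diagEdge (suc j)
  ∷ []) (upTo (n ∸ 1))

-- m^{(k)}_{(p,q)} = m  for the curve γᴸ_(p,q) with crossed edges τs.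
module γᴸ (k : ℕ) (pq : ℤ × ℤ) (τs : List Edge) =
  CurvePoset k τs (rightOfγ pq) (λ i → closerRightγ pq (lookup τs i))

NumIdealsH : ℕ → ℕ → ℕ → Set
NumIdealsH k n m = γᴸ.NumOrderIdeals k (+ n , + 0) (edgesH n) m

NumIdealsD : ℕ → ℕ → ℕ → Set
NumIdealsD k n m = γᴸ.NumOrderIdeals k (+ n , + n) (edgesD n) m

xSeq : ℕ → ℕ → ℤ
xSeq k 0 = + 0
xSeq k 1 = + 1
xSeq k (suc (suc n)) = + (2 ℕ.* k ℕ.+ 3) * xSeq k (suc n) - xSeq k n

ySeq : ℕ → ℕ → ℤ
ySeq k 0 = + 0
ySeq k 1 = + (k ℕ.+ 2)
ySeq k (suc (suc n)) =
  + (3 ℕ.* k ℕ.* k ℕ.+ 8 ℕ.* k ℕ.+ 6) * ySeq k (suc n) - ySeq k n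

{-# OPTIONS --safe #-}

-- 𝒫_γ is a fence: one chain of k+1 elements per crossed edge, consecutive chains joined
-- by a single cover relation. An order ideal meets each chain in one of its k+2 down-sets,
-- and the only interaction with the next chain is through the last element of this one,
-- which may force the first element of the next. Counting ideals chain by chain is thus a
-- product of 2×2 transfer matrices acting on the pair (count with the next head free,
-- count with it forced). The edges crossed by γᴸ_(n,0) and γᴸ_(n,n) repeat a period of
-- 2, resp. 4, edges whose transfer matrix has determinant 1 and trace 2k+3, resp.
-- 3k²+8k+6, so by Cayley–Hamilton the counts satisfy the two recurrences; the vector
-- (0, 1) is mapped to the first state, which accounts for x₀ = y₀ = 0.

module Submission where

open import Defs
open import Data.Nat using (ℕ; _≤_)
open import Data.Integer using (+_)
open import Data.Product using (Σ; _×_)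
open import Relation.Binary.PropositionalEquality using (_≡_)

open import Data.Bool using (Bool; true; false; not; if_then_else_)
open import Data.Bool.Properties using (not-¬; ¬-not)
import Data.Bool as Bool
open import Data.Empty using (⊥; ⊥-elim)
open import Data.Fin using (Fin; zero; suc; inject₁; fromℕ)
open import Data.Integer as ℤ using (ℤ; _⊖_; -_; ∣_∣)
import Data.Integer.Properties as ℤ
open import Data.List as List using (List; []; _∷_; _++_; map; length; concatMap; applyUpTo; upTo)
import Data.List.Properties as List
open import Data.List.Membership.Propositional using (_∈_; find; lose)
open import Data.List.Membership.Propositional.Properties using (∈-map⁺; ∈-map⁻; ∈-concatMap⁺; ∈-concatMap⁻)
import Data.List.Relation.Unary.All as All
open import Data.List.Relation.Unary.Any using (here; there)
open import Data.List.Relation.Unary.AllPairs using ([]; _∷_)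
open import Data.List.Relation.Unary.Unique.Propositional using (Unique)
import Data.List.Relation.Unary.Unique.Propositional.Properties as Unique
open import Data.Maybe using (Maybe; just; nothing)
open import Data.Nat using (zero; suc; _+_; _*_; _<ᵇ_)
open import Data.Nat.ListAction using (sum)
open import Data.Nat.Properties using (+-identityʳ; +-assoc; +-suc; *-zeroʳ; *-distribˡ-+; m≤n+m; m+n∸n≡m; suc-injective)
open import Data.Nat.Tactic.RingSolver using (solve-∀)
open import Data.Product using (_,_; proj₁; proj₂; map₁)
open import Data.Unit using (⊤; tt)
open import Data.Vec as Vec using (Vec; []; _∷_; replicate)
open import Data.Vec.Properties using (lookup-replicate; ∷-injective; ∷-injectiveˡ; ∷-injectiveʳ)
open import Function using (_∘_; id)
open import Function.Bundles using (_⇔_; mk⇔; Equivalence)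
open Equivalence using (to; from)
open import Relation.Binary.Construct.Closure.ReflexiveTransitive using (ε; _◅_; fold)
open import Relation.Binary.PropositionalEquality using (_≢_; refl; sym; trans; cong; cong₂; subst; module ≡-Reasoning)
open import Relation.Nullary using (¬_; yes; no)

contraposeᵇ : ∀ b {x y} → (x ≡ b → y ≡ b) → y ≡ not b → x ≡ not b
contraposeᵇ b x→y y≡¬b = ¬-not (λ x≡b → not-¬ refl (trans (sym (x→y x≡b)) y≡¬b))

<ᵇ-irrefl : ∀ n → (n <ᵇ n) ≡ false
<ᵇ-irrefl zero    = refl
<ᵇ-irrefl (suc n) = <ᵇ-irrefl n

[m+n]⊖n≡m : ∀ m n → (m + n) ⊖ n ≡ + m
[m+n]⊖n≡m m n = trans (ℤ.⊖-≥ (m≤n+m n m)) (cong +_ (m+n∸n≡m m n))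

-- Monotone Boolean rows

Monotone : Bool → ∀ {m} → Vec Bool m → Set
Monotone b []          = ⊤
Monotone b (_ ∷ [])    = ⊤
Monotone b (x ∷ y ∷ v) = (x ≡ b → y ≡ b) × Monotone b (y ∷ v)

monotone⇔lookup : ∀ {b m} (v : Vec Bool (suc m)) →
  Monotone b v ⇔ (∀ (j : Fin m) → Vec.lookup v (inject₁ j) ≡ b → Vec.lookup v (suc j) ≡ b)
monotone⇔lookup {b} v = mk⇔ (steps v) (fromSteps v)
  where
  steps : ∀ {m} (v : Vec Bool (suc m)) → Monotone b v →
          ∀ j → Vec.lookup v (inject₁ j) ≡ b → Vec.lookup v (suc j) ≡ b
  steps (x ∷ y ∷ v) (step , _) zero    = step
  steps (x ∷ y ∷ v) (_ , mono) (suc j) = steps (y ∷ v) mono j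

  fromSteps : ∀ {m} (v : Vec Bool (suc m)) →
              (∀ j → Vec.lookup v (inject₁ j) ≡ b → Vec.lookup v (suc j) ≡ b) → Monotone b v
  fromSteps (x ∷ [])    _    = tt
  fromSteps (x ∷ y ∷ v) step = step zero , fromSteps (y ∷ v) (step ∘ suc)

replicate-monotone : ∀ b m → Monotone b (replicate m b)
replicate-monotone b zero          = tt
replicate-monotone b (suc zero)    = tt
replicate-monotone b (suc (suc m)) = (λ _ → refl) , replicate-monotone b (suc m)

monotone-∷ : ∀ b {m} (v : Vec Bool m) → Monotone b v → Monotone b (not b ∷ v)
monotone-∷ b []      _    = tt
monotone-∷ b (_ ∷ _) mono = (λ ¬b≡b → ⊥-elim (not-¬ refl (sym ¬b≡b))) , mono

monotone-tail : ∀ b {m} x (v : Vec Bool m) → Monotone b (x ∷ v) → Monotone b v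
monotone-tail b x []      _          = tt
monotone-tail b x (_ ∷ _) (_ , mono) = mono

monotone-replicate : ∀ b {m} (v : Vec Bool m) → Monotone b (b ∷ v) → v ≡ replicate m b
monotone-replicate b []      _             = refl
monotone-replicate b (y ∷ v) (b→y , mono) with b→y refl
... | refl = cong (b ∷_) (monotone-replicate b v mono)

monotoneRows  : Bool → (m : ℕ) → List (Vec Bool m)
switchingRows : Bool → (m : ℕ) → List (Vec Bool (suc m))

monotoneRows b zero    = [] ∷ []
monotoneRows b (suc m) = replicate (suc m) b ∷ switchingRows b m

switchingRows b m = map (not b ∷_) (monotoneRows b m)

∈-monotoneRows⁻ : ∀ b {m} {v : Vec Bool m} → v ∈ monotoneRows b m → Monotone b v
∈-monotoneRows⁻ b {zero}  {[]} _      = tt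
∈-monotoneRows⁻ b {suc m} (here refl) = replicate-monotone b (suc m)
∈-monotoneRows⁻ b {suc m} (there v∈)  with ∈-map⁻ (not b ∷_) v∈
... | w , w∈ , refl = monotone-∷ b w (∈-monotoneRows⁻ b w∈)

∈-monotoneRows⁺ : ∀ b {m} (v : Vec Bool m) → Monotone b v → v ∈ monotoneRows b m
∈-monotoneRows⁺ b []      _ = here refl
∈-monotoneRows⁺ b (x ∷ v) mono with x Bool.≟ b
... | yes refl = here (cong (b ∷_) (monotone-replicate b v mono))
... | no x≢b   with ¬-not x≢b
...   | refl = there (∈-map⁺ (not b ∷_) (∈-monotoneRows⁺ b v (monotone-tail b x v mono)))

monotoneRows-unique : ∀ b m → Unique (monotoneRows b m)
monotoneRows-unique b zero    = All.[] ∷ []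
monotoneRows-unique b (suc m) =
  All.tabulate replicate∉ ∷ Unique.map⁺ ∷-injectiveʳ (monotoneRows-unique b m)
  where
  replicate∉ : ∀ {v} → v ∈ switchingRows b m → replicate (suc m) b ≢ v
  replicate∉ v∈ eq with ∈-map⁻ (not b ∷_) v∈
  ... | _ , _ , refl = not-¬ refl (∷-injectiveˡ eq)

last : ∀ {m} → Vec Bool (suc m) → Bool
last {m} v = Vec.lookup v (fromℕ m)

sum-last-switchingRows : ∀ b m (h : Bool → ℕ) →
  sum (map (h ∘ last) (switchingRows b m)) ≡ m * h b + h (not b)
sum-last-switchingRows b zero    h = +-identityʳ (h (not b))
sum-last-switchingRows b (suc m) h = begin
  h (last (replicate (suc m) b)) + sum (map (h ∘ last) (map (not b ∷_) (switchingRows b m)))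
    ≡⟨ cong₂ _+_ (cong h (lookup-replicate (fromℕ m) b))
                 (cong sum (sym (List.map-∘ (switchingRows b m)))) ⟩
  h b + sum (map (h ∘ last) (switchingRows b m))
    ≡⟨ cong (_+_ (h b)) (sum-last-switchingRows b m h) ⟩
  h b + (m * h b + h (not b))
    ≡⟨ sym (+-assoc (h b) _ _) ⟩
  suc m * h b + h (not b) ∎
  where open ≡-Reasoning

module _ {A : Set} {n : ℕ} where

  dependentCons : List A → (A → List (Vec A n)) → List (Vec A (suc n))
  dependentCons xs g = concatMap (λ x → map (x ∷_) (g x)) xs

  ∈-dependentCons : ∀ xs g {x v} → (x ∷ v) ∈ dependentCons xs g ⇔ (x ∈ xs × v ∈ g x)
  ∈-dependentCons xs g =
    mk⇔ split (λ (x∈ , v∈) → ∈-concatMap⁺ _ (lose x∈ (∈-map⁺ (_ ∷_) v∈)))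
    where
    split : ∀ {x v} → (x ∷ v) ∈ dependentCons xs g → x ∈ xs × v ∈ g x
    split xv∈ with find (∈-concatMap⁻ _ {xs = xs} xv∈)
    ... | y , y∈ , xv∈′ with ∈-map⁻ (y ∷_) xv∈′
    ...   | w , w∈ , eq with ∷-injective eq
    ...     | refl , refl = y∈ , w∈

  dependentCons-unique : ∀ {xs} g → Unique xs → (∀ x → Unique (g x)) → Unique (dependentCons xs g)
  dependentCons-unique {[]}     g _            _  = []
  dependentCons-unique {x ∷ xs} g (x∉ ∷ uniq) ug =
    Unique.++⁺ (Unique.map⁺ ∷-injectiveʳ (ug x)) (dependentCons-unique g uniq ug) disjoint
    where
    disjoint : ∀ {v} → ¬ (v ∈ map (x ∷_) (g x) × v ∈ dependentCons xs g)
    disjoint (v∈ , v∈rest) with ∈-map⁻ (x ∷_) v∈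
    ... | _ , _ , refl = All.lookup x∉ (proj₁ (to (∈-dependentCons xs g) v∈rest)) refl

  length-dependentCons : ∀ xs g → length (dependentCons xs g) ≡ sum (map (length ∘ g) xs)
  length-dependentCons []       g = refl
  length-dependentCons (x ∷ xs) g = trans (List.length-++ (map (x ∷_) (g x)))
    (cong₂ _+_ (List.length-map (x ∷_) (g x)) (length-dependentCons xs g))

concatMapFrom : {A : Set} → (ℕ → List A) → ℕ → ℕ → List A
concatMapFrom g a zero    = []
concatMapFrom g a (suc m) = g a ++ concatMapFrom g (suc a) m

concatMap-upTo : {A : Set} (g : ℕ → List A) (m : ℕ) → concatMap g (upTo m) ≡ concatMapFrom g 0 m
concatMap-upTo g m = shifted (λ x → refl) m
  where
  shifted : ∀ {f a} → (∀ x → f x ≡ a + x) →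
            ∀ m → concatMap g (applyUpTo f m) ≡ concatMapFrom g a m
  shifted         f≡a+ zero    = refl
  shifted {f} {a} f≡a+ (suc m) = cong₂ _++_ (cong g (trans (f≡a+ 0) (+-identityʳ a)))
    (shifted (λ x → trans (f≡a+ (suc x)) (+-suc a x)) m)

-- Transfer matrices of determinant one

cayley-hamilton₂ : ∀ {a b c d} → a * d ≡ 1 + b * c → ∀ x y →
  a * (a * x + b * y) + b * (c * x + d * y) + x ≡ (a + d) * (a * x + b * y)
cayley-hamilton₂ {a} {b} {c} {d} det x y = begin
  a * (a * x + b * y) + b * (c * x + d * y) + x
    ≡⟨ regroup a b c d x y ⟩
  a * (a * x + b * y) + d * (b * y) + (1 + b * c) * x
    ≡⟨ cong (λ t → a * (a * x + b * y) + d * (b * y) + t * x) (sym det) ⟩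
  a * (a * x + b * y) + d * (b * y) + a * d * x
    ≡⟨ factor a b d x y ⟩
  (a + d) * (a * x + b * y) ∎
  where
  open ≡-Reasoning
  regroup : ∀ a b c d x y → a * (a * x + b * y) + b * (c * x + d * y) + x
                          ≡ a * (a * x + b * y) + d * (b * y) + (1 + b * c) * x
  regroup = solve-∀
  factor : ∀ a b d x y → a * (a * x + b * y) + d * (b * y) + a * d * x ≡ (a + d) * (a * x + b * y)
  factor = solve-∀

transfer-recurrence : ∀ {a b c d} {u w : ℕ → ℕ} → a * d ≡ 1 + b * c →
  (∀ m → u (suc m) ≡ a * u m + b * w m) →
  (∀ m → w (suc m) ≡ c * u m + d * w m) →
  ∀ m → u (2 + m) + u m ≡ (a + d) * u (1 + m)
transfer-recurrence {a} {b} {c} {d} {u} {w} det u-step w-step m = begin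
  u (2 + m) + u m
    ≡⟨ cong (_+ u m) (u-step (suc m)) ⟩
  a * u (1 + m) + b * w (1 + m) + u m
    ≡⟨ cong₂ (λ x y → a * x + b * y + u m) (u-step m) (w-step m) ⟩
  a * (a * u m + b * w m) + b * (c * u m + d * w m) + u m
    ≡⟨ cayley-hamilton₂ {a} {b} {c} {d} det (u m) (w m) ⟩
  (a + d) * (a * u m + b * w m)
    ≡⟨ cong ((a + d) *_) (sym (u-step m)) ⟩
  (a + d) * u (1 + m) ∎
  where open ≡-Reasoning

agree-by-recurrence : ∀ t {s : ℕ → ℤ} {f : ℕ → ℕ} →
  (∀ n → s (2 + n) ≡ + t ℤ.* s (1 + n) ℤ.- s n) →
  (∀ n → f (2 + n) + f n ≡ t * f (1 + n)) →
  s 0 ≡ + f 0 → s 1 ≡ + f 1 → ∀ n → s n ≡ + f n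
agree-by-recurrence t {s} {f} s-rec f-rec s₀ s₁ n = proj₁ (agree n)
  where
  open ≡-Reasoning
  agree : ∀ n → s n ≡ + f n × s (1 + n) ≡ + f (1 + n)
  agree zero    = s₀ , s₁
  agree (suc n) = let (sₙ , sₙ₊₁) = agree n in sₙ₊₁ , (begin
    s (2 + n)                             ≡⟨ s-rec n ⟩
    + t ℤ.* s (1 + n) ℤ.- s n             ≡⟨ cong₂ (λ x y → + t ℤ.* x ℤ.- y) sₙ₊₁ sₙ ⟩
    + t ℤ.* + f (1 + n) ℤ.- + f n         ≡⟨ cong (ℤ._- + f n) (sym (ℤ.pos-* t (f (1 + n)))) ⟩
    + (t * f (1 + n)) ℤ.- + f n           ≡⟨ cong (λ x → + x ℤ.- + f n) (sym (f-rec n)) ⟩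
    + (f (2 + n) + f n) ℤ.- + f n         ≡⟨ ℤ.[+m]-[+n]≡m⊖n (f (2 + n) + f n) (f n) ⟩
    (f (2 + n) + f n) ⊖ f n               ≡⟨ [m+n]⊖n≡m (f (2 + n)) (f n) ⟩
    + f (2 + n)                           ∎)

-- Fences and the order ideals of 𝒫_γ

-- One entry per chain of 𝒫_γ: its orientation (closerRight) and the direction (rightOf the
-- common endpoint) of its link to the next chain; the direction of the last link is unused.
Fence : Set
Fence = List (Bool × Bool)

-- The constraint on the head of the next chain across a link of direction B, when the
-- current chain ends in z.
forced : Bool → Bool → Maybe Bool
forced true  true  = just true
forced false false = just false
forced _     _     = nothing

module Counting (k : ℕ) where

  Row : Set
  Row = Vec Bool (suc k)

  HeadOK : Maybe Bool → Row → Set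
  HeadOK nothing  _ = ⊤
  HeadOK (just x) R = Vec.lookup R zero ≡ x

  FirstRowOK : Maybe Bool → ∀ {r} → Vec Row r → Set
  FirstRowOK c []      = ⊤
  FirstRowOK c (R ∷ _) = HeadOK c R

  firstRowOK-nothing : ∀ {r} (S : Vec Row r) → FirstRowOK nothing S
  firstRowOK-nothing []      = tt
  firstRowOK-nothing (_ ∷ _) = tt

  headOK-forced : ∀ B z (R : Row) → HeadOK (forced B z) R ⇔ (z ≡ B → Vec.lookup R zero ≡ B)
  headOK-forced true  true  R = mk⇔ (λ h _ → h) (λ f → f refl)
  headOK-forced false false R = mk⇔ (λ h _ → h) (λ f → f refl)
  headOK-forced true  false R = mk⇔ (λ _ ()) (λ _ → tt)
  headOK-forced false true  R = mk⇔ (λ _ ()) (λ _ → tt)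

  rowsWithHead : Bool → Maybe Bool → List Row
  rowsWithHead b     nothing      = monotoneRows b (suc k)
  rowsWithHead true  (just true)  = replicate (suc k) true ∷ []
  rowsWithHead false (just false) = replicate (suc k) false ∷ []
  rowsWithHead true  (just false) = switchingRows true k
  rowsWithHead false (just true)  = switchingRows false k

  ∈-constantRow : ∀ {b} {R : Row} →
    R ∈ replicate (suc k) b ∷ [] ⇔ (Vec.lookup R zero ≡ b × Monotone b R)
  ∈-constantRow {b} {x ∷ v} = mk⇔ (λ { (here refl) → refl , replicate-monotone b (suc k) })
    (λ (x≡b , mono) → here (cong₂ _∷_ x≡b
      (monotone-replicate b v (subst (λ y → Monotone b (y ∷ v)) x≡b mono))))

  ∈-switchingRows : ∀ {b} {R : Row} →
    R ∈ switchingRows b k ⇔ (Vec.lookup R zero ≡ not b × Monotone b R)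
  ∈-switchingRows {b} {x ∷ v} = mk⇔ split
    (λ (x≡¬b , mono) → subst (λ y → y ∷ v ∈ switchingRows b k) (sym x≡¬b)
                         (∈-map⁺ (not b ∷_) (∈-monotoneRows⁺ b v (monotone-tail b x v mono))))
    where
    split : x ∷ v ∈ switchingRows b k → x ≡ not b × Monotone b (x ∷ v)
    split xv∈ with ∈-map⁻ (not b ∷_) xv∈
    ... | w , w∈ , refl = refl , monotone-∷ b w (∈-monotoneRows⁻ b w∈)

  ∈-rowsWithHead : ∀ b c {R} → R ∈ rowsWithHead b c ⇔ (HeadOK c R × Monotone b R)
  ∈-rowsWithHead b     nothing      =
    mk⇔ (λ R∈ → tt , ∈-monotoneRows⁻ b R∈) (∈-monotoneRows⁺ b _ ∘ proj₂)
  ∈-rowsWithHead true  (just true)  = ∈-constantRow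
  ∈-rowsWithHead false (just false) = ∈-constantRow
  ∈-rowsWithHead true  (just false) = ∈-switchingRows
  ∈-rowsWithHead false (just true)  = ∈-switchingRows

  rowsWithHead-unique : ∀ b c → Unique (rowsWithHead b c)
  rowsWithHead-unique b     nothing      = monotoneRows-unique b (suc k)
  rowsWithHead-unique true  (just true)  = All.[] ∷ []
  rowsWithHead-unique false (just false) = All.[] ∷ []
  rowsWithHead-unique true  (just false) = Unique.map⁺ ∷-injectiveʳ (monotoneRows-unique true k)
  rowsWithHead-unique false (just true)  = Unique.map⁺ ∷-injectiveʳ (monotoneRows-unique false k)

  switchingWeight : Bool → (Bool → ℕ) → ℕ
  switchingWeight b h = k * h b + h (not b)

  rowWeight : Bool → Maybe Bool → (Bool → ℕ) → ℕ
  rowWeight b     nothing      h = h b + switchingWeight b h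
  rowWeight true  (just true)  h = h true
  rowWeight false (just false) h = h false
  rowWeight true  (just false) h = switchingWeight true h
  rowWeight false (just true)  h = switchingWeight false h

  sum-rowsWithHead : ∀ b c (h : Bool → ℕ) → sum (map (h ∘ last) (rowsWithHead b c)) ≡ rowWeight b c h
  sum-rowsWithHead b     nothing      h =
    cong₂ _+_ (cong h (lookup-replicate (fromℕ k) b)) (sum-last-switchingRows b k h)
  sum-rowsWithHead true  (just true)  h = trans (+-identityʳ _) (cong h (lookup-replicate (fromℕ k) true))
  sum-rowsWithHead false (just false) h = trans (+-identityʳ _) (cong h (lookup-replicate (fromℕ k) false))
  sum-rowsWithHead true  (just false) h = sum-last-switchingRows true k h
  sum-rowsWithHead false (just true)  h = sum-last-switchingRows false k h

  fenceCount : Maybe Bool → Fence → ℕ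
  fenceCount c []             = 1
  fenceCount c ((b , B) ∷ f) = rowWeight b c (λ z → fenceCount (forced B z) f)

module Description (ro : Point → Bool) (cr : Edge → Bool) where

  LinkDirection : Edge → List Edge → Bool → Set
  LinkDirection e []       B = ⊤
  LinkDirection e (e′ ∷ _) B = ro (commonEndpoint e e′) ≡ B

  Describes : List Edge → Fence → Set
  Describes []       []             = ⊤
  Describes (e ∷ es) ((b , B) ∷ f) = cr e ≡ b × LinkDirection e es B × Describes es f
  Describes _        _              = ⊥

module CurveIdeals (k : ℕ) (ro : Point → Bool) (cr : Edge → Bool) where
  open Counting k
  open Description ro cr

  module 𝒫 (τs : List Edge) = CurvePoset k τs ro (λ i → cr (List.lookup τs i))
  open CurvePoset using (chainDown; chainUp; linkDown; linkUp)

  CoverClosed : (τs : List Edge) → 𝒫.SubsetP τs → Set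
  CoverClosed τs S = ∀ {x y} → 𝒫._⋖_ τs x y → 𝒫._∈ₛ_ τs y S → 𝒫._∈ₛ_ τs x S

  isOrderIdeal⇔coverClosed : ∀ τs S → 𝒫.IsOrderIdeal τs S ⇔ CoverClosed τs S
  isOrderIdeal⇔coverClosed τs S = mk⇔ ideal⇒closed closed⇒ideal
    where
    open 𝒫 τs using (_∈ₛ_)
    ideal⇒closed : 𝒫.IsOrderIdeal τs S → CoverClosed τs S
    ideal⇒closed ideal x⋖y = ideal _ _ (x⋖y ◅ ε)
    closed⇒ideal : CoverClosed τs S → 𝒫.IsOrderIdeal τs S
    closed⇒ideal closed _ _ =
      fold (λ x y → y ∈ₛ S → x ∈ₛ S) (λ x⋖y y→z z∈ → closed x⋖y (y→z z∈)) id

  nextHead : Edge → List Edge → Bool → Maybe Bool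
  nextHead e []       _ = nothing
  nextHead e (e′ ∷ _) z = forced (ro (commonEndpoint e e′)) z

  Valid : (τs : List Edge) → Vec Row (length τs) → Set
  Valid []       []      = ⊤
  Valid (e ∷ es) (R ∷ S) = Monotone (cr e) R × FirstRowOK (nextHead e es (last R)) S × Valid es S

  lift⋖ : ∀ {e es x y} → 𝒫._⋖_ es x y → 𝒫._⋖_ (e ∷ es) (map₁ suc x) (map₁ suc y)
  lift⋖ (chainDown i j p)     = chainDown (suc i) j p
  lift⋖ (chainUp i j p)       = chainUp (suc i) j p
  lift⋖ (linkDown i i′ q p)   = linkDown (suc i) (suc i′) (cong suc q) p
  lift⋖ (linkUp i i′ q p)     = linkUp (suc i) (suc i′) (cong suc q) p

  closed⇒monotone : ∀ {e es R S} → CoverClosed (e ∷ es) (R ∷ S) → Monotone (cr e) R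
  closed⇒monotone {e} {R = R} closed = from (monotone⇔lookup R) step
    where
    step : ∀ j → Vec.lookup R (inject₁ j) ≡ cr e → Vec.lookup R (suc j) ≡ cr e
    step j with cr e in eq
    ... | true  = closed (chainDown zero j eq)
    ... | false = contraposeᵇ true (closed (chainUp zero j eq))

  closed⇒firstRowOK : ∀ {e es R S} → CoverClosed (e ∷ es) (R ∷ S) →
                      FirstRowOK (nextHead e es (last R)) S
  closed⇒firstRowOK {es = []}     {S = []}     _      = tt
  closed⇒firstRowOK {e} {e′ ∷ _} {R} {R′ ∷ _} closed = from (headOK-forced _ (last R) R′) link
    where
    link : last R ≡ ro (commonEndpoint e e′) → Vec.lookup R′ zero ≡ ro (commonEndpoint e e′)
    link with ro (commonEndpoint e e′) in eq
    ... | true  = closed (linkDown zero (suc zero) refl eq)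
    ... | false = contraposeᵇ true (closed (linkUp zero (suc zero) refl eq))

  closed-∷ : ∀ {e es R S} → Monotone (cr e) R → FirstRowOK (nextHead e es (last R)) S →
             CoverClosed es S → CoverClosed (e ∷ es) (R ∷ S)
  closed-∷ {R = R} mono _ _ (chainDown zero j p) =
    to (monotone⇔lookup R) (subst (λ b → Monotone b R) p mono) j
  closed-∷ {R = R} mono _ _ (chainUp zero j p) =
    contraposeᵇ false (to (monotone⇔lookup R) (subst (λ b → Monotone b R) p mono) j)
  closed-∷ _ _ closed (chainDown (suc i) j p) = closed (chainDown i j p)
  closed-∷ _ _ closed (chainUp (suc i) j p)   = closed (chainUp i j p)
  closed-∷ {es = _ ∷ _} {R} {R′ ∷ _} _ first _ (linkDown zero (suc zero) _ p) =
    subst (λ B → last R ≡ B → Vec.lookup R′ zero ≡ B) p (to (headOK-forced _ _ R′) first)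
  closed-∷ {es = _ ∷ _} {R} {R′ ∷ _} _ first _ (linkUp zero (suc zero) _ p) =
    contraposeᵇ false
      (subst (λ B → last R ≡ B → Vec.lookup R′ zero ≡ B) p (to (headOK-forced _ _ R′) first))
  closed-∷ {es = _ ∷ _} {S = _ ∷ _} _ _ closed (linkDown (suc i) (suc i′) q p) =
    closed (linkDown i i′ (suc-injective q) p)
  closed-∷ {es = _ ∷ _} {S = _ ∷ _} _ _ closed (linkUp (suc i) (suc i′) q p) =
    closed (linkUp i i′ (suc-injective q) p)
  closed-∷ _ _ _ (linkDown zero zero () _)
  closed-∷ _ _ _ (linkUp zero zero () _)
  closed-∷ _ _ _ (linkDown (suc _) zero () _)
  closed-∷ _ _ _ (linkUp (suc _) zero () _)
  closed-∷ {es = _ ∷ _} _ _ _ (linkDown zero (suc (suc _)) () _)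
  closed-∷ {es = _ ∷ _} _ _ _ (linkUp zero (suc (suc _)) () _)

  coverClosed⇒valid : ∀ τs (S : Vec Row (length τs)) → CoverClosed τs S → Valid τs S
  coverClosed⇒valid []       []      _      = tt
  coverClosed⇒valid (e ∷ es) (R ∷ S) closed = closed⇒monotone closed , closed⇒firstRowOK closed ,
    coverClosed⇒valid es S (λ x⋖y → closed (lift⋖ x⋖y))

  valid⇒coverClosed : ∀ τs (S : Vec Row (length τs)) → Valid τs S → CoverClosed τs S
  valid⇒coverClosed []       []      _ {() , _}
  valid⇒coverClosed (e ∷ es) (R ∷ S) (mono , first , valid) =
    closed-∷ mono first (valid⇒coverClosed es S valid)

  validArrays : Maybe Bool → (τs : List Edge) → List (Vec Row (length τs))
  validArrays c []       = [] ∷ []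
  validArrays c (e ∷ es) =
    dependentCons (rowsWithHead (cr e) c) (λ R → validArrays (nextHead e es (last R)) es)

  ∈-validArrays : ∀ c τs {S} → S ∈ validArrays c τs ⇔ (FirstRowOK c S × Valid τs S)
  ∈-validArrays c []       {[]}    = mk⇔ (λ _ → tt , tt) (λ _ → here refl)
  ∈-validArrays c (e ∷ es) {R ∷ S} = mk⇔
    (λ RS∈ → let (R∈ , S∈) = to (∈-dependentCons _ _) RS∈
                 (head , mono) = to (∈-rowsWithHead (cr e) c) R∈
                 (first , valid) = to (∈-validArrays _ es) S∈
             in head , mono , first , valid)
    (λ (head , mono , first , valid) → from (∈-dependentCons _ _)
      (from (∈-rowsWithHead (cr e) c) (head , mono) , from (∈-validArrays _ es) (first , valid)))

  validArrays-unique : ∀ c τs → Unique (validArrays c τs)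
  validArrays-unique c []       = All.[] ∷ []
  validArrays-unique c (e ∷ es) =
    dependentCons-unique _ (rowsWithHead-unique (cr e) c) (λ R → validArrays-unique _ es)

  isOrderIdeal⇔∈validArrays : ∀ τs S → 𝒫.IsOrderIdeal τs S ⇔ S ∈ validArrays nothing τs
  isOrderIdeal⇔∈validArrays τs S = mk⇔
    (λ ideal → from (∈-validArrays nothing τs)
      (firstRowOK-nothing S , coverClosed⇒valid τs S (to (isOrderIdeal⇔coverClosed τs S) ideal)))
    (λ S∈ → from (isOrderIdeal⇔coverClosed τs S)
      (valid⇒coverClosed τs S (proj₂ (to (∈-validArrays nothing τs) S∈))))

  nextHead-describes : ∀ {e es B f} → LinkDirection e es B → Describes es f →
                       ∀ z → fenceCount (nextHead e es z) f ≡ fenceCount (forced B z) f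
  nextHead-describes {es = []}    {f = []} _    _ z = refl
  nextHead-describes {es = _ ∷ _} {f = f}  link _ z = cong (λ B → fenceCount (forced B z) f) link

  length-validArrays : ∀ c τs f → Describes τs f → length (validArrays c τs) ≡ fenceCount c f
  length-validArrays c []       []             _                   = refl
  length-validArrays c (e ∷ es) ((b , B) ∷ f) (cr≡b , link , desc) = begin
    length (validArrays c (e ∷ es))
      ≡⟨ length-dependentCons (rowsWithHead (cr e) c) _ ⟩
    sum (map (completions ∘ last) (rowsWithHead (cr e) c))
      ≡⟨ cong (λ b → sum (map (completions ∘ last) (rowsWithHead b c))) cr≡b ⟩
    sum (map (completions ∘ last) (rowsWithHead b c))
      ≡⟨ cong sum (List.map-cong (completions≡ ∘ last) (rowsWithHead b c)) ⟩
    sum (map (fenceCompletions ∘ last) (rowsWithHead b c))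
      ≡⟨ sum-rowsWithHead b c fenceCompletions ⟩
    fenceCount c ((b , B) ∷ f) ∎
    where
    open ≡-Reasoning
    completions fenceCompletions : Bool → ℕ
    completions z      = length (validArrays (nextHead e es z) es)
    fenceCompletions z = fenceCount (forced B z) f
    completions≡ : ∀ z → completions z ≡ fenceCompletions z
    completions≡ z = trans (length-validArrays _ es f desc) (nextHead-describes link desc z)

  numOrderIdeals : ∀ τs f → Describes τs f → 𝒫.NumOrderIdeals τs (fenceCount nothing f)
  numOrderIdeals τs f desc = validArrays nothing τs , validArrays-unique nothing τs ,
    isOrderIdeal⇔∈validArrays τs , length-validArrays nothing τs f desc

-- The periodic fences of γᴸ_(n,0) and γᴸ_(n,n)

horizontalFence : ℕ → Fence
horizontalFence zero    = []
horizontalFence (suc m) = (true , true) ∷ (true , false) ∷ horizontalFence m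

-- Periods start at a diagonal edge; the last diagonal edge of γᴸ_(n,n) closes the fence.
diagonalFence : ℕ → Fence
diagonalFence zero    = (false , false) ∷ []
diagonalFence (suc m) = (false , false) ∷ (true , true) ∷ (true , true) ∷ (true , false) ∷ diagonalFence m

module FenceSequences (k : ℕ) where
  open Counting k

  -- At index 0 these are not counts: (0, 1) is the state that the transfer matrix of F
  -- maps to the state at index 1, so that freeCount F 0 = 0 = x₀ = y₀.
  freeCount falseHeadCount : (ℕ → Fence) → ℕ → ℕ
  freeCount      F zero    = 0
  freeCount      F (suc m) = fenceCount nothing (F m)
  falseHeadCount F zero    = 1
  falseHeadCount F (suc m) = fenceCount (just false) (F m)

  initial-step : ∀ a b → b ≡ a * 0 + b * 1
  initial-step = solve-∀

  -- In each `block` identity the left-hand side is fenceCount unfolded over one period,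
  -- p and q being the two counts of the rest of the fence.
  module HorizontalTransfer where
    a b c d : ℕ
    a = 2 * k + 2
    b = 1
    c = 2 * k + 1
    d = 1

    u w : ℕ → ℕ
    u = freeCount horizontalFence
    w = falseHeadCount horizontalFence

    u-step : ∀ m → u (suc m) ≡ a * u m + b * w m
    u-step zero    = initial-step a b
    u-step (suc m) = block k (u (suc m)) (w (suc m))
      where
      block : ∀ k p q → p + (k * p + (p + (k * p + q))) ≡ (2 * k + 2) * p + 1 * q
      block = solve-∀

    w-step : ∀ m → w (suc m) ≡ c * u m + d * w m
    w-step zero    = initial-step c d
    w-step (suc m) = block k (u (suc m)) (w (suc m))
      where
      block : ∀ k p q → k * p + (p + (k * p + q)) ≡ (2 * k + 1) * p + 1 * q
      block = solve-∀

    det : a * d ≡ 1 + b * c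
    det = lemma k
      where
      lemma : ∀ k → (2 * k + 2) * 1 ≡ 1 + 1 * (2 * k + 1)
      lemma = solve-∀

  module DiagonalTransfer where
    a b c d : ℕ
    a = 3 * k * k + 8 * k + 5
    b = k + 2
    c = 3 * k + 2
    d = 1

    u w : ℕ → ℕ
    u = freeCount diagonalFence
    w = falseHeadCount diagonalFence

    u-one : u 1 ≡ k + 2
    u-one = lemma k
      where
      lemma : ∀ k → 1 + (k * 1 + 1) ≡ k + 2
      lemma = solve-∀

    u-step : ∀ m → u (suc m) ≡ a * u m + b * w m
    u-step zero    = trans u-one (initial-step a b)
    u-step (suc m) = block k (u (suc m)) (w (suc m))
      where
      block : ∀ k p q →
        let r₁ = p + (k * p + q)
            r₂ = p + (k * p + r₁)
            s  = k * p + r₂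
        in s + (k * s + (p + (k * p + r₂))) ≡ (3 * k * k + 8 * k + 5) * p + (k + 2) * q
      block = solve-∀

    w-step : ∀ m → w (suc m) ≡ c * u m + d * w m
    w-step zero    = initial-step c d
    w-step (suc m) = block k (u (suc m)) (w (suc m))
      where
      block : ∀ k p q → k * p + (p + (k * p + (p + (k * p + q)))) ≡ (3 * k + 2) * p + 1 * q
      block = solve-∀

    det : a * d ≡ 1 + b * c
    det = lemma k
      where
      lemma : ∀ k → (3 * k * k + 8 * k + 5) * 1 ≡ 1 + (k + 2) * (3 * k + 2)
      lemma = solve-∀

  xSeq≡freeCount : ∀ n → xSeq k n ≡ + freeCount horizontalFence n
  xSeq≡freeCount = agree-by-recurrence (2 * k + 3) (λ _ → refl) recurrence refl refl
    where
    open HorizontalTransfer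
    recurrence : ∀ m → u (2 + m) + u m ≡ (2 * k + 3) * u (1 + m)
    recurrence m = trans (transfer-recurrence {a} {b} {c} {d} {u} {w} det u-step w-step m)
      (cong (_* u (1 + m)) (+-assoc (2 * k) 2 1))

  ySeq≡freeCount : ∀ n → ySeq k n ≡ + freeCount diagonalFence n
  ySeq≡freeCount =
    agree-by-recurrence (3 * k * k + 8 * k + 6) (λ _ → refl) recurrence refl (cong +_ (sym u-one))
    where
    open DiagonalTransfer
    recurrence : ∀ m → u (2 + m) + u m ≡ (3 * k * k + 8 * k + 6) * u (1 + m)
    recurrence m = trans (transfer-recurrence {a} {b} {c} {d} {u} {w} det u-step w-step m)
      (cong (_* u (1 + m)) (+-assoc (3 * k * k + 8 * k) 5 1))

-- Geometry of the crossings

cross-ℕ : ∀ p q a b → cross (+ p , + q) (+ a , + b) ≡ p * b ⊖ q * a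
cross-ℕ p q a b = trans (cong₂ ℤ._-_ (sym (ℤ.pos-* p b)) (sym (ℤ.pos-* q a)))
  (ℤ.[+m]-[+n]≡m⊖n (p * b) (q * a))

rightOfγ-commonEndpoint : ∀ pq e e′ {X c} → commonEndpoint e e′ ≡ X → cross pq X ≡ c →
  rightOfγ pq (commonEndpoint e e′) ≡ (c ℤ.≤ᵇ + 0)
rightOfγ-commonEndpoint pq e e′ common≡X cross≡c =
  trans (cong (rightOfγ pq) common≡X) (cong (ℤ._≤ᵇ + 0) cross≡c)

closerRightγ-cross : ∀ pq e {x y} → cross pq (end₁ e) ≡ x → cross pq (end₂ e) ≡ y →
  closerRightγ pq e ≡ (if x ℤ.≤ᵇ + 0 then ∣ x ∣ <ᵇ ∣ y ∣ else ∣ y ∣ <ᵇ ∣ x ∣)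
closerRightγ-cross pq (edge A B) =
  cong₂ (λ x y → if x ℤ.≤ᵇ + 0 then ∣ x ∣ <ᵇ ∣ y ∣ else ∣ y ∣ <ᵇ ∣ x ∣)

closerRightγ-fromLine : ∀ pq e {d} → cross pq (end₁ e) ≡ + 0 → cross pq (end₂ e) ≡ + suc d →
  closerRightγ pq e ≡ true
closerRightγ-fromLine pq e = closerRightγ-cross pq e

closerRightγ-midpoint : ∀ pq e {d} →
  cross pq (end₁ e) ≡ + suc d → cross pq (end₂ e) ≡ - + suc d →
  closerRightγ pq e ≡ false
closerRightγ-midpoint pq e {d} A≡ B≡ = trans (closerRightγ-cross pq e A≡ B≡) (<ᵇ-irrefl d)

commonEndpoint-end₁ : ∀ e e′ → end₁ e ≡ end₁ e′ → commonEndpoint e e′ ≡ end₁ e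
commonEndpoint-end₁ (edge A B) (edge C D) A≡C with A ≟ₚ C | A ≟ₚ D
... | yes _  | _     = refl
... | no _   | yes _ = refl
... | no A≢C | no _  = ⊥-elim (A≢C A≡C)

commonEndpoint-end₂ : ∀ e e′ → end₁ e ≡ end₂ e′ → commonEndpoint e e′ ≡ end₁ e
commonEndpoint-end₂ (edge A B) (edge C D) A≡D with A ≟ₚ C | A ≟ₚ D
... | yes _ | _      = refl
... | no _  | yes _  = refl
... | no _  | no A≢D = ⊥-elim (A≢D A≡D)

commonEndpoint-other : ∀ e e′ → end₁ e ≢ end₁ e′ → end₁ e ≢ end₂ e′ →
  commonEndpoint e e′ ≡ end₂ e
commonEndpoint-other (edge A B) (edge C D) A≢C A≢D with A ≟ₚ C | A ≟ₚ D
... | yes A≡C | _       = ⊥-elim (A≢C A≡C)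
... | no _    | yes A≡D = ⊥-elim (A≢D A≡D)
... | no _    | no _    = refl

module HorizontalCurve (n : ℕ) where
  pq : ℤ × ℤ
  pq = (+ suc n , + 0)
  open Description (rightOfγ pq) (closerRightγ pq)

  slantEdge verticalEdge : ℕ → Edge
  slantEdge a    = edge (+ suc a , + 0) (+ a , + 1)
  verticalEdge a = edge (+ suc a , + 0) (+ suc a , + 1)

  crossedBlock : ℕ → List Edge
  crossedBlock a = slantEdge a ∷ verticalEdge a ∷ []

  cross-onLine : ∀ a → cross pq (+ a , + 0) ≡ + 0
  cross-onLine a = trans (cross-ℕ (suc n) 0 a 0) (cong +_ (*-zeroʳ (suc n)))

  cross-above : ∀ a → cross pq (+ a , + 1) ≡ + suc (n * 1)
  cross-above a = cross-ℕ (suc n) 0 a 1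

  link-vertical : ∀ a m → LinkDirection (verticalEdge a) (concatMapFrom crossedBlock (suc a) m) false
  link-vertical a zero    = tt
  link-vertical a (suc m) = rightOfγ-commonEndpoint pq (verticalEdge a) (slantEdge (suc a))
    (commonEndpoint-other (verticalEdge a) (slantEdge (suc a)) (λ ()) (λ ())) (cross-above (suc a))

  describes : ∀ a m → Describes (concatMapFrom crossedBlock a m) (horizontalFence m)
  describes a zero    = tt
  describes a (suc m) =
      closerRightγ-fromLine pq (slantEdge a) (cross-onLine (suc a)) (cross-above a)
    , rightOfγ-commonEndpoint pq (slantEdge a) (verticalEdge a)
        (commonEndpoint-end₁ (slantEdge a) (verticalEdge a) refl) (cross-onLine (suc a))
    , closerRightγ-fromLine pq (verticalEdge a) (cross-onLine (suc a)) (cross-above (suc a))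
    , link-vertical a m
    , describes (suc a) m

  numIdealsH : ∀ k → NumIdealsH k (suc n) (Counting.fenceCount k nothing (horizontalFence n))
  numIdealsH k = CurveIdeals.numOrderIdeals k (rightOfγ pq) (closerRightγ pq)
    (edgesH (suc n)) (horizontalFence n)
    (subst (λ τs → Describes τs (horizontalFence n)) (sym (concatMap-upTo crossedBlock n))
      (describes 0 n))

module DiagonalCurve (n : ℕ) where
  pq : ℤ × ℤ
  pq = (+ suc n , + suc n)
  open Description (rightOfγ pq) (closerRightγ pq)

  westEdge northwestEdge northEdge : ℕ → Edge
  westEdge a      = edge (+ suc a , + suc a) (+ a , + suc a)
  northwestEdge a = edge (+ suc a , + suc a) (+ a , + suc (suc a))
  northEdge a     = edge (+ suc a , + suc a) (+ suc a , + suc (suc a))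

  crossedBlock : ℕ → List Edge
  crossedBlock a = westEdge a ∷ northwestEdge a ∷ northEdge a ∷ diagEdge (suc a) ∷ []

  difference : ∀ a d → (suc n * (d + a)) ⊖ (suc n * a) ≡ + (suc n * d)
  difference a d = trans (cong (_⊖ (suc n * a)) (*-distribˡ-+ (suc n) d a))
    ([m+n]⊖n≡m (suc n * d) (suc n * a))

  cross-above : ∀ a d → cross pq (+ a , + (d + a)) ≡ + (suc n * d)
  cross-above a d = trans (cross-ℕ (suc n) (suc n) a (d + a)) (difference a d)

  cross-below : ∀ a d → cross pq (+ (d + a) , + a) ≡ - + (suc n * d)
  cross-below a d = trans (cross-ℕ (suc n) (suc n) (d + a) a)
    (trans (ℤ.⊖-swap (suc n * a) (suc n * (d + a))) (cong -_ (difference a d)))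

  cross-onLine : ∀ a → cross pq (+ a , + a) ≡ + 0
  cross-onLine a = trans (cross-above a 0) (cong +_ (*-zeroʳ (suc n)))

  diagEdge-orientation : ∀ a → closerRightγ pq (diagEdge a) ≡ false
  diagEdge-orientation a = closerRightγ-midpoint pq (diagEdge a) (cross-above a 1) (cross-below a 1)

  describes : ∀ a m → Describes (diagEdge a ∷ concatMapFrom crossedBlock a m) (diagonalFence m)
  describes a zero    = diagEdge-orientation a , tt , tt
  describes a (suc m) =
      diagEdge-orientation a
    , rightOfγ-commonEndpoint pq (diagEdge a) (westEdge a)
        (commonEndpoint-end₂ (diagEdge a) (westEdge a) refl) (cross-above a 1)
    , closerRightγ-fromLine pq (westEdge a) (cross-onLine (suc a)) (cross-above a 1)
    , rightOfγ-commonEndpoint pq (westEdge a) (northwestEdge a)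
        (commonEndpoint-end₁ (westEdge a) (northwestEdge a) refl) (cross-onLine (suc a))
    , closerRightγ-fromLine pq (northwestEdge a) (cross-onLine (suc a)) (cross-above a 2)
    , rightOfγ-commonEndpoint pq (northwestEdge a) (northEdge a)
        (commonEndpoint-end₁ (northwestEdge a) (northEdge a) refl) (cross-onLine (suc a))
    , closerRightγ-fromLine pq (northEdge a) (cross-onLine (suc a)) (cross-above (suc a) 1)
    , rightOfγ-commonEndpoint pq (northEdge a) (diagEdge (suc a))
        (commonEndpoint-other (northEdge a) (diagEdge (suc a)) (λ ()) (λ ())) (cross-above (suc a) 1)
    , describes (suc a) m

  numIdealsD : ∀ k → NumIdealsD k (suc n) (Counting.fenceCount k nothing (diagonalFence n))
  numIdealsD k = CurveIdeals.numOrderIdeals k (rightOfγ pq) (closerRightγ pq)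
    (edgesD (suc n)) (diagonalFence n)
    (subst (λ τs → Describes (diagEdge 0 ∷ τs) (diagonalFence n)) (sym (concatMap-upTo crossedBlock n))
      (describes 0 n))

lemma4p2 : (k : ℕ) →
    ((n : ℕ) → 1 ≤ n → Σ ℕ (λ m → NumIdealsH k n m × + m ≡ xSeq k n))
    × ((n : ℕ) → 1 ≤ n → Σ ℕ (λ m → NumIdealsD k n m × + m ≡ ySeq k n))
lemma4p2 k = horizontal , diagonal
  where
  open FenceSequences k
  horizontal : (n : ℕ) → 1 ≤ n → Σ ℕ (λ m → NumIdealsH k n m × + m ≡ xSeq k n)
  horizontal (suc n) _ =
    freeCount horizontalFence (suc n) , HorizontalCurve.numIdealsH n k , sym (xSeq≡freeCount (suc n))
  diagonal : (n : ℕ) → 1 ≤ n → Σ ℕ (λ m → NumIdealsD k n m × + m ≡ ySeq k n)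
  diagonal (suc n) _ =
    freeCount diagonalFence (suc n) , DiagonalCurve.numIdealsD n k , sym (ySeq≡freeCount (suc n))
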